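{- The following hold for the Maker-Breaker total domination game. (1) There are infinitely many connected cubic graphs $G$ such that Staller has a winning strategy in the S-game on $G$. (2) No minimum degree condition is sufficient to guarantee that Dominator wins the S-game; that is, for every integer $\delta_0$ there is a graph $G$ with minimum degree $\delta(G)\ge \delta_0$ on which Staller has a winning strategy in the S-game.
   Context: All graphs are finite and simple. The Maker-Breaker total domination (MBTD) game on a graph $G$ is played by two players, Dominator and Staller, who alternately select a vertex of $G$ not selected before. Dominator wins if at some point the set of vertices he has selected is a total dominating set of $G$ (a set $D$ such that every vertex of $G$ has a neighbour in $D$); otherwise Staller wins, equivalently Staller wins if she selects all vertices of the open neighbourhood $N(v)$ of some vertex $v$. The D-game is the game in which Dominator moves first; the S-game is the game in which Staller moves first. -}

module Defs where

open import Data.Nat using (ℕ; zero; suc; _+_; _≤_; _<_)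
open import Data.Fin using (Fin; _≟_)
open import Data.Bool using (Bool; true; false; if_then_else_)
open import Data.Vec.Functional using (Vector; foldr)
open import Data.Product using (Σ; ∃; _×_; _,_)
open import Relation.Nullary using (¬_; yes; no)
open import Relation.Binary.PropositionalEquality using (_≡_; _≢_)

record Graph (n : ℕ) : Set where
  field
    adj   : Fin n → Fin n → Bool
    sym   : ∀ u v → adj u v ≡ adj v u
    irrefl : ∀ v → adj v v ≡ false
open Graph public

deg : ∀ {n} → Graph n → Fin n → ℕ
deg G v = foldr _+_ 0 (λ w → if adj G v w then 1 else 0)

Cubic : ∀ {n} → Graph n → Set
Cubic G = ∀ v → deg G v ≡ 3

MinDegreeAtLeast : ∀ {n} → Graph n → ℕ → Set
MinDegreeAtLeast G d = ∀ v → d ≤ deg G v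

data Walk {n} (G : Graph n) : Fin n → Fin n → Set where
  here : ∀ {u} → Walk G u u
  step : ∀ {u v w} → adj G u v ≡ true → Walk G v w → Walk G u w

Connected : ∀ {n} → Graph n → Set
Connected {n} G = 0 < n × (∀ u v → Walk G u v)

data Owner : Set where
  free dom stal : Owner

Position : ℕ → Set
Position n = Fin n → Owner

initial : ∀ {n} → Position n
initial _ = free

claim : ∀ {n} → Position n → Fin n → Owner → Position n
claim p v o w with w ≟ v
... | yes _ = o
... | no  _ = p w

DomTD : ∀ {n} → Graph n → Position n → Set
DomTD {n} G p = ∀ u → Σ (Fin n) λ w → adj G u w ≡ true × p w ≡ dom

data Player : Set where
  Dominator Staller : Player

-- StallerWins G p t : from position p with player t to move, Staller has a
-- winning strategy, i.e. she can ensure that Dominator's set never becomes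
-- a total dominating set of G before all vertices have been selected.
data StallerWins {n} (G : Graph n) : Position n → Player → Set where
  ended   : ∀ {p t} → ¬ DomTD G p → (∀ v → p v ≢ free) → StallerWins G p t
  s-move  : ∀ {p} v → ¬ DomTD G p → p v ≡ free →
            StallerWins G (claim p v stal) Dominator → StallerWins G p Staller
  d-move  : ∀ {p} → ¬ DomTD G p →
            (∀ v → p v ≡ free → StallerWins G (claim p v dom) Staller) →
            StallerWins G p Dominator

StallerWinsSGame : ∀ {n} → Graph n → Set
StallerWinsSGame G = StallerWins G initial Staller

module Submission where

open import Defs hiding (sym)
open import Data.Nat using (ℕ; zero; suc; _+_; _*_; _^_; _≤_; _<_; z≤n; s≤s)
open import Data.Nat.Induction using (<-wellFounded)
open import Data.Fin.Induction using (<-weakInduction)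
open import Data.Nat.Properties
  using (+-suc; +-assoc; ≤-reflexive; ≤-trans; m≤m+n; m≤n+m; m^n>0; n≤1+n; m≤m*n)
open import Data.Fin
  using (Fin; zero; suc; _≟_; _↑ˡ_; _↑ʳ_; splitAt; join; finToFun; funToFin; fromℕ; inject₁; punchIn)
open import Data.Fin.Properties
  using ( any?; all?; suc-injective; 2↔Bool; *↔×; toℕ<n
        ; splitAt-↑ˡ; splitAt-↑ʳ; join-splitAt; finToFun-funToFin)
open import Data.Bool using (Bool; true; false; if_then_else_; _∨_; not)
open import Data.Bool.Properties using (not-injective; ∨-zeroʳ)
open import Data.Vec.Functional using (foldr)
open import Data.Product using (Σ; ∃; ∃₂; _×_; _,_; proj₁; proj₂)
open import Data.Sum using (_⊎_; inj₁; inj₂)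
import Data.Maybe as Maybe
open import Data.Maybe using (Maybe; just; nothing)
open import Data.Maybe.Properties using (just-injective)
open import Data.Unit using (tt)
open import Data.List using (List; []; _∷_)
open import Data.Vec using (lookup; []; _∷_)
open import Data.Fin.Patterns using (0F; 1F; 2F; 3F; 4F; 5F; 6F; 7F; 8F; 9F)
open import Function using (_∘_; Inverse; _↔_; _⇔_; mk⇔)
open import Function.Definitions using (Injective)
open import Induction.WellFounded using (Acc; acc)
open import Relation.Nullary
  using (¬_; Dec; yes; no; does; contradiction; _×-dec_; _⊎-dec_; _→-dec_; ¬?)
open import Relation.Nullary.Decidable using (dec-true; dec-false; does-⇔; toWitness)
open import Relation.Binary.Definitions using (DecidableEquality)
open import Relation.Binary.PropositionalEquality
  using (_≡_; _≢_; refl; sym; trans; cong; cong₂; subst; module ≡-Reasoning)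

-- (1) Glue k + 1 copies of a cubic graph on ten vertices into a ring: in every copy the edge {0, 1}
-- is cut and vertex 0 is joined to vertex 1 of the previous copy. The result is connected and
-- cubic, and vertices 2..9 of a copy have all their neighbours inside that copy. A decision tree
-- for Staller, checked by evaluation, shows that by playing only inside copy 0 she claims the
-- whole neighbourhood of one of its inner vertices, whatever Dominator does anywhere.
--
-- (2) Take vertices x j, y j (j < d), all x j adjacent to all y j, and for every subset S of the
-- indices a vertex t S adjacent to x j for j ∈ S and to y j for j ∉ S; every degree is at least d.
-- Staller answers Dominator's move on x j or y j by claiming its partner, so Dominator never owns
-- both; then t S, for S the set of j with x j not Dominator's, has no neighbour of Dominator.

indicator : Bool → ℕ
indicator b = if b then 1 else 0

count : ∀ {n} → (Fin n → Bool) → ℕ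
count f = foldr _+_ 0 (indicator ∘ f)

count-cong : ∀ {n} {f g : Fin n → Bool} → (∀ w → f w ≡ g w) → count f ≡ count g
count-cong {zero}          f≗g = refl
count-cong {suc n} {f} {g} f≗g rewrite f≗g zero =
  cong (indicator (g zero) +_) (count-cong (f≗g ∘ suc))

count-false : ∀ n → count {n} (λ _ → false) ≡ 0
count-false zero    = refl
count-false (suc n) = count-false n

count-true : ∀ n → count {n} (λ _ → true) ≡ n
count-true zero    = refl
count-true (suc n) = cong suc (count-true n)

count-≟ : ∀ {n} (a : Fin n) → count (λ w → does (w ≟ a)) ≡ 1
count-≟ {suc n} zero    = cong suc (count-false n)
count-≟ {suc n} (suc a) = count-≟ a

count-∨ : ∀ {n} {f g : Fin n → Bool} → (∀ w → f w ≡ true → g w ≡ false) →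
          count (λ w → f w ∨ g w) ≡ count f + count g
count-∨ {zero}          disjoint = refl
count-∨ {suc n} {f} {g} disjoint with f zero in f₀ | g zero in g₀
... | true  | true  with () ← trans (sym (disjoint zero f₀)) g₀
... | true  | false = cong suc (count-∨ (disjoint ∘ suc))
... | false | true  = trans (cong suc (count-∨ (disjoint ∘ suc))) (sym (+-suc _ _))
... | false | false = count-∨ (disjoint ∘ suc)

count-complement : ∀ {n} (f : Fin n → Bool) → count f + count (not ∘ f) ≡ n
count-complement {zero}  f = refl
count-complement {suc n} f with f zero
... | true  = cong suc (count-complement (f ∘ suc))
... | false = trans (+-suc _ _) (cong suc (count-complement (f ∘ suc)))

count-+ : ∀ a {b} (f : Fin (a + b) → Bool) → count f ≡ count (f ∘ (_↑ˡ b)) + count (f ∘ (a ↑ʳ_))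
count-+ zero    f = refl
count-+ (suc a) f =
  trans (cong (indicator (f zero) +_) (count-+ a (f ∘ suc))) (sym (+-assoc (indicator (f zero)) _ _))

count-unset : ∀ {n} (f g : Fin n → Bool) v → f v ≡ true → g v ≡ false →
              (∀ w → w ≢ v → f w ≡ g w) → count f ≡ suc (count g)
count-unset f g zero    fv gv f≗g rewrite fv | gv = cong suc (count-cong λ w → f≗g (suc w) λ ())
count-unset f g (suc v) fv gv f≗g rewrite f≗g zero (λ ()) =
  trans (cong (indicator (g zero) +_) (count-unset (f ∘ suc) (g ∘ suc) v fv gv f≗g-on-suc))
        (+-suc (indicator (g zero)) _)
  where
  f≗g-on-suc : ∀ w → w ≢ v → f (suc w) ≡ g (suc w)
  f≗g-on-suc w w≢v = f≗g (suc w) (w≢v ∘ suc-injective)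

≟-disjoint : ∀ {n} {a b : Fin n} → a ≢ b → ∀ w → does (w ≟ a) ≡ true → does (w ≟ b) ≡ false
≟-disjoint {a = a} {b} a≢b w wa with w ≟ a
≟-disjoint {a = a} {b} a≢b w wa | yes refl = dec-false (a ≟ b) a≢b

_≟ₒ_ : DecidableEquality Owner
free ≟ₒ free = yes refl
free ≟ₒ dom  = no λ ()
free ≟ₒ stal = no λ ()
dom  ≟ₒ free = no λ ()
dom  ≟ₒ dom  = yes refl
dom  ≟ₒ stal = no λ ()
stal ≟ₒ free = no λ ()
stal ≟ₒ dom  = no λ ()
stal ≟ₒ stal = yes refl

module _ {n} (p : Position n) where

  claim-self : ∀ v o → claim p v o v ≡ o
  claim-self v o with v ≟ v
  ... | yes _   = refl
  ... | no v≢v = contradiction refl v≢v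

  claim-other : ∀ {v w} o → w ≢ v → claim p v o w ≡ p w
  claim-other {v} {w} o w≢v with w ≟ v
  ... | yes w≡v = contradiction w≡v w≢v
  ... | no _    = refl

  claim-stal : ∀ v w → claim p v stal w ≡ stal ⊎ claim p v stal w ≡ p w
  claim-stal v w with w ≟ v
  ... | yes _ = inj₁ refl
  ... | no _  = inj₂ refl

HasFree : ∀ {n} → Position n → Set
HasFree p = ∃ λ v → p v ≡ free

freeCount : ∀ {n} → Position n → ℕ
freeCount p = count λ w → does (p w ≟ₒ free)

freeCount-claim : ∀ {n} (p : Position n) {v} o → p v ≡ free → o ≢ free →
                  freeCount (claim p v o) < freeCount p
freeCount-claim p {v} o pv o≢free =
  ≤-reflexive (sym (count-unset _ _ v freeBefore takenAfter unchanged))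
  where
  freeBefore : does (p v ≟ₒ free) ≡ true
  freeBefore rewrite pv = refl
  takenAfter : does (claim p v o v ≟ₒ free) ≡ false
  takenAfter rewrite claim-self p v o = dec-false (o ≟ₒ free) o≢free
  unchanged : ∀ w → w ≢ v → does (p w ≟ₒ free) ≡ does (claim p v o w ≟ₒ free)
  unchanged w w≢v rewrite claim-other p o w≢v = refl

domTD-claim-stal : ∀ {n} {G : Graph n} {q : Position n} {w} →
                   q w ≢ dom → DomTD G q → DomTD G (claim q w stal)
domTD-claim-stal {q = q} qw≢dom td u with td u
... | x , ux , qx = x , ux , trans (claim-other q stal λ { refl → qw≢dom qx }) qx

-- Strategies maintaining an invariant

CanRestore : ∀ {n} → Graph n → (Position n → Set) → Position n → Set
CanRestore G Good p = ¬ DomTD G p × (HasFree p → ∃ λ u → p u ≡ free × Good (claim p u stal))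

module ByInvariant {n} (G : Graph n) (Good : Position n → Set)
  (good⇒¬TD : ∀ {p} → Good p → ¬ DomTD G p)
  (reply : ∀ {p v} → Good p → p v ≡ free → CanRestore G Good (claim p v dom))
  where

  mutual
    restoring-wins : ∀ {p} → Acc _<_ (freeCount p) → CanRestore G Good p →
                     StallerWins G p Staller
    restoring-wins {p} (acc rs) (¬td , restore) with any? (λ v → p v ≟ₒ free)
    ... | no full = ended ¬td λ v pv → full (v , pv)
    ... | yes hasFree with restore hasFree
    ... | u , pu , good = s-move u ¬td pu (good-wins (rs (freeCount-claim p stal pu λ ())) good)

    good-wins : ∀ {p} → Acc _<_ (freeCount p) → Good p → StallerWins G p Dominator
    good-wins {p} (acc rs) good =
      d-move (good⇒¬TD good) λ v pv →
        restoring-wins (rs (freeCount-claim p dom pv λ ())) (reply good pv)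

  stallerWinsSGame : CanRestore G Good initial → StallerWinsSGame G
  stallerWinsSGame = restoring-wins (<-wellFounded _)

record Isolated {n} (G : Graph n) (p : Position n) : Set where
  constructor isolates
  field
    centre    : Fin n
    stal-nbhd : ∀ w → adj G centre w ≡ true → p w ≡ stal

module _ {n} {G : Graph n} {p : Position n} where

  isolated⇒¬TD : Isolated G p → ¬ DomTD G p
  isolated⇒¬TD (isolates v stal-nbhd) td with td v
  ... | w , vw , pw with () ← trans (sym pw) (stal-nbhd w vw)

  isolated-claim : ∀ {v} o → Isolated G p → p v ≡ free → Isolated G (claim p v o)
  isolated-claim {v} o (isolates c stal-nbhd) pv =
    isolates c λ w cw → trans (claim-other p o (w≢v w cw)) (stal-nbhd w cw)
    where
    w≢v : ∀ w → adj G c w ≡ true → w ≢ v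
    w≢v w cw refl with () ← trans (sym (stal-nbhd w cw)) pv

-- Winning locally on a gadget

module LocalGame {g s r : ℕ} (nbhd : Fin s → Fin r → Fin g) where

  Isolating : Position g → Set
  Isolating q = ∃ λ i → ∀ l → q (nbhd i l) ≡ stal

  Open : Position g → Set
  Open q = ∃ λ i → ∀ l → q (nbhd i l) ≢ dom

  -- After Staller's move, `next nothing` continues when Dominator plays outside the gadget and
  -- `next (just u)` when he claims u; `finish` means completing a neighbourhood in one move.
  data Strategy : Set where
    finish : Strategy
    play   : Fin g → (Maybe (Fin g) → Strategy) → Strategy

  mutual
    Wins : Strategy → Position g → Set
    Wins finish        q = Isolating q ⊎ (Open q × ∃ λ j → q j ≡ free × Isolating (claim q j stal))
    Wins (play j next) q = Open q × q j ≡ free × Answers next (claim q j stal)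

    Answers : (Maybe (Fin g) → Strategy) → Position g → Set
    Answers next q = Isolating q ⊎
      (Open q × Wins (next nothing) q × (∀ u → q u ≡ free → Wins (next (just u)) (claim q u dom)))

  isolating? : ∀ q → Dec (Isolating q)
  isolating? q = any? λ i → all? λ l → q (nbhd i l) ≟ₒ stal

  open? : ∀ q → Dec (Open q)
  open? q = any? λ i → all? λ l → ¬? (q (nbhd i l) ≟ₒ dom)

  mutual
    wins? : ∀ st q → Dec (Wins st q)
    wins? finish q =
      isolating? q ⊎-dec (open? q ×-dec any? λ j → (q j ≟ₒ free) ×-dec isolating? (claim q j stal))
    wins? (play j next) q = open? q ×-dec ((q j ≟ₒ free) ×-dec answers? next (claim q j stal))

    answers? : ∀ next q → Dec (Answers next q)
    answers? next q = isolating? q ⊎-dec (open? q ×-dec (wins? (next nothing) q ×-dec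
      all? λ u → (q u ≟ₒ free) →-dec wins? (next (just u)) (claim q u dom)))

module LocalStrategy {n g s r} (G : Graph n)
  (e : Fin g → Fin n) (e-injective : Injective _≡_ _≡_ e)
  (nbhd : Fin s → Fin r → Fin g) (centre : Fin s → Fin n)
  (nbhd-local : ∀ i w → adj G (centre i) w ≡ true → ∃ λ l → w ≡ e (nbhd i l))
  where
  open LocalGame nbhd

  Agrees : Position n → Position g → Set
  Agrees p q = ∀ j → p (e j) ≡ q j

  module _ {p : Position n} {q : Position g} (agrees : Agrees p q) where

    isolating⇒isolated : Isolating q → Isolated G p
    isolating⇒isolated (i , isolating) =
      isolates (centre i) λ w cw → nbhd-stal w (nbhd-local i w cw)
      where
      nbhd-stal : ∀ w → ∃ (λ l → w ≡ e (nbhd i l)) → p w ≡ stal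
      nbhd-stal _ (l , refl) = trans (agrees _) (isolating l)

    open⇒¬TD : Open q → ¬ DomTD G p
    open⇒¬TD (i , opn) td with td (centre i)
    ... | w , cw , pw with nbhd-local i w cw
    ... | l , refl = opn l (trans (sym (agrees _)) pw)

    agrees-claim : ∀ j o → Agrees (claim p (e j) o) (claim q j o)
    agrees-claim j o i with i ≟ j
    ... | yes refl = claim-self p (e i) o
    ... | no i≢j   = trans (claim-other p o (i≢j ∘ e-injective)) (agrees i)

    agrees-claim-outside : ∀ {v} o → (∀ j → e j ≢ v) → Agrees (claim p v o) q
    agrees-claim-outside o outside j = trans (claim-other p o (outside j)) (agrees j)

  Good : Position n → Set
  Good p = Isolated G p ⊎ ∃₂ λ next q → Agrees p q × Answers next q

  good⇒¬TD : ∀ {p} → Good p → ¬ DomTD G p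
  good⇒¬TD (inj₁ isolated)                          = isolated⇒¬TD isolated
  good⇒¬TD (inj₂ (_ , _ , agrees , inj₁ isolating)) = isolated⇒¬TD (isolating⇒isolated agrees isolating)
  good⇒¬TD (inj₂ (_ , _ , agrees , inj₂ (opn , _))) = open⇒¬TD agrees opn

  isolated⇒canRestore : ∀ {p} → Isolated G p → CanRestore G Good p
  isolated⇒canRestore isolated =
    isolated⇒¬TD isolated , λ (u , pu) → u , pu , inj₁ (isolated-claim stal isolated pu)

  wins⇒canRestore : ∀ {p q} st → Agrees p q → Wins st q → CanRestore G Good p
  wins⇒canRestore finish agrees (inj₁ isolating) =
    isolated⇒canRestore (isolating⇒isolated agrees isolating)
  wins⇒canRestore finish agrees (inj₂ (opn , j , qj , isolating)) =
    open⇒¬TD agrees opn ,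
    λ _ → e j , trans (agrees j) qj , inj₁ (isolating⇒isolated (agrees-claim agrees j stal) isolating)
  wins⇒canRestore (play j next) agrees (opn , qj , answers) =
    open⇒¬TD agrees opn ,
    λ _ → e j , trans (agrees j) qj , inj₂ (next , _ , agrees-claim agrees j stal , answers)

  reply : ∀ {p v} → Good p → p v ≡ free → CanRestore G Good (claim p v dom)
  reply (inj₁ isolated) pv = isolated⇒canRestore (isolated-claim dom isolated pv)
  reply (inj₂ (_ , _ , agrees , inj₁ isolating)) pv =
    isolated⇒canRestore (isolated-claim dom (isolating⇒isolated agrees isolating) pv)
  reply {v = v} (inj₂ (_ , _ , agrees , inj₂ (_ , pass , answer))) pv with any? (λ j → e j ≟ v)
  ... | yes (j , refl) =
    wins⇒canRestore _ (agrees-claim agrees j dom) (answer j (trans (sym (agrees j)) pv))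
  ... | no outside =
    wins⇒canRestore _ (agrees-claim-outside agrees dom λ j ej≡v → outside (j , ej≡v)) pass

  stallerWins : ∀ st → Wins st (λ _ → free) → StallerWinsSGame G
  stallerWins st wins =
    ByInvariant.stallerWinsSGame G Good good⇒¬TD reply (wins⇒canRestore st (λ _ → refl) wins)

-- Pairing strategies

data Safe : Owner → Owner → Set where
  stal-left  : ∀ {b} → Safe stal b
  stal-right : ∀ {a} → Safe a stal
  both-free  : Safe free free

safe-¬dom-dom : ∀ {a b} → Safe a b → a ≡ dom → b ≢ dom
safe-¬dom-dom stal-left  ()
safe-¬dom-dom stal-right _ ()
safe-¬dom-dom both-free  ()

safe-stal : ∀ {a b a′ b′} → Safe a b → a′ ≡ stal ⊎ a′ ≡ a → b′ ≡ stal ⊎ b′ ≡ b → Safe a′ b′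
safe-stal _    (inj₁ refl) _           = stal-left
safe-stal _    (inj₂ refl) (inj₁ refl) = stal-right
safe-stal safe (inj₂ refl) (inj₂ refl) = safe

safe-free : ∀ {b} → Safe free b → b ≢ free → b ≡ stal
safe-free stal-right _      = refl
safe-free both-free  b≢free = contradiction refl b≢free

module Pairing {n} (G : Graph n) (mate : Fin n → Maybe (Fin n))
  (mate-sym    : ∀ {v w} → mate v ≡ just w → mate w ≡ just v)
  (mate-irrefl : ∀ {v w} → mate v ≡ just w → v ≢ w)
  (split⇒¬TD   : ∀ {p} → (∀ {v w} → mate v ≡ just w → p v ≡ dom → p w ≢ dom) → ¬ DomTD G p)
  where

  Good : Position n → Set
  Good p = ∀ {v w} → mate v ≡ just w → Safe (p v) (p w)

  good⇒¬TD : ∀ {p} → Good p → ¬ DomTD G p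
  good⇒¬TD good = split⇒¬TD λ m → safe-¬dom-dom (good m)

  canRestore : ∀ {p} → Good p → CanRestore G Good p
  canRestore {p} good =
    good⇒¬TD good , λ (u , pu) → u , pu , λ m → safe-stal (good m) (claim-stal p u _) (claim-stal p u _)

  mate-unique : ∀ {a b c} → mate a ≡ just b → mate a ≡ just c → b ≡ c
  mate-unique m m′ = just-injective (trans (sym m) m′)

  reply : ∀ {p v} → Good p → p v ≡ free → CanRestore G Good (claim p v dom)
  reply {p} {v} good pv with mate v in mv
  ... | nothing = canRestore unpaired
    where
    unpaired : Good (claim p v dom)
    unpaired {a} {b} m with a ≟ v | b ≟ v
    ... | yes refl | _        with () ← trans (sym mv) m
    ... | no _     | yes refl with () ← trans (sym mv) (mate-sym m)
    ... | no _     | no _     = good m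
  ... | just w with p w ≟ₒ free
  ...   | no pw≢free = canRestore covered
    where
    pw-stal : p w ≡ stal
    pw-stal = safe-free (subst (λ a → Safe a (p w)) pv (good mv)) pw≢free
    covered : Good (claim p v dom)
    covered {a} {b} m with a ≟ v | b ≟ v
    ... | yes refl | yes refl = contradiction refl (mate-irrefl m)
    ... | yes refl | no _     rewrite mate-unique m mv | pw-stal = stal-right
    ... | no _     | yes refl rewrite mate-unique (mate-sym m) mv | pw-stal = stal-left
    ... | no _     | no _     = good m
  ...   | yes pw =
    (λ td → good⇒¬TD blocked (domTD-claim-stal {G = G} w≢dom td)) , λ _ → w , w-free , blocked
    where
    w-free : claim p v dom w ≡ free
    w-free = trans (claim-other p dom (mate-irrefl mv ∘ sym)) pw
    w≢dom : claim p v dom w ≢ dom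
    w≢dom w-dom with () ← trans (sym w-free) w-dom
    blocked : Good (claim (claim p v dom) w stal)
    blocked {a} {b} m with a ≟ w | b ≟ w
    ... | yes refl | _        = stal-left
    ... | no _     | yes refl = stal-right
    ... | no a≢w   | no b≢w   with a ≟ v | b ≟ v
    ...   | yes refl | _        = contradiction (mate-unique m mv) b≢w
    ...   | no _     | yes refl = contradiction (mate-unique (mate-sym m) mv) a≢w
    ...   | no _     | no _     = good m

  stallerWins : StallerWinsSGame G
  stallerWins = ByInvariant.stallerWinsSGame G Good good⇒¬TD reply (canRestore λ _ → both-free)

module _ {n} {G : Graph n} where

  walk-++ : ∀ {u v w} → Walk G u v → Walk G v w → Walk G u w
  walk-++ here         q = q
  walk-++ (step uv p) q = step uv (walk-++ p q)

  walk-reverse : ∀ {u v} → Walk G u v → Walk G v u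
  walk-reverse here                 = here
  walk-reverse (step {u} {v} uv p) =
    walk-++ (walk-reverse p) (step (trans (Graph.sym G v u) uv) here)

  connected-from : (r : Fin n) → (∀ v → Walk G r v) → Connected G
  connected-from r reach =
    ≤-trans (s≤s z≤n) (toℕ<n r) , λ u v → walk-++ (walk-reverse (reach u)) (reach v)

-- Cubic graphs from three perfect matchings

module ThreeMatchings {n} {V : Set} (ι : Fin n ↔ V) (τ : Fin 3 → V → V)
  (τ-involutive   : ∀ i a → τ i (τ i a) ≡ a)
  (τ-fixpointFree : ∀ i a → τ i a ≢ a)
  (τ-distinct     : ∀ {i j} → i ≢ j → ∀ a → τ i a ≢ τ j a)
  where
  open Inverse ι

  σ : Fin 3 → Fin n → Fin n
  σ i v = from (τ i (to v))

  to-σ : ∀ i v → to (σ i v) ≡ τ i (to v)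
  to-σ i v = strictlyInverseˡ _

  σ-involutive : ∀ i v → σ i (σ i v) ≡ v
  σ-involutive i v =
    trans (cong (from ∘ τ i) (to-σ i v)) (trans (cong from (τ-involutive i _)) (strictlyInverseʳ v))

  σ-distinct : ∀ {i j} → i ≢ j → ∀ v → σ i v ≢ σ j v
  σ-distinct i≢j v σiv≡σjv =
    τ-distinct i≢j _ (trans (sym (to-σ _ v)) (trans (cong to σiv≡σjv) (to-σ _ v)))

  σ-sym : ∀ i v w → w ≡ σ i v ⇔ v ≡ σ i w
  σ-sym i v w = mk⇔ (λ { refl → sym (σ-involutive i v) }) (λ { refl → sym (σ-involutive i w) })

  edge : Fin 3 → Fin n → Fin n → Bool
  edge i v w = does (w ≟ σ i v)

  edge-sym : ∀ i v w → edge i v w ≡ edge i w v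
  edge-sym i v w = does-⇔ (σ-sym i v w) (w ≟ σ i v) (v ≟ σ i w)

  edge-irrefl : ∀ i v → edge i v v ≡ false
  edge-irrefl i v = dec-false (v ≟ σ i v) λ v≡σiv →
    τ-fixpointFree i (to v) (trans (sym (to-σ i v)) (cong to (sym v≡σiv)))

  edge-disjoint : ∀ {i j} → i ≢ j → ∀ v w → edge i v w ≡ true → edge j v w ≡ false
  edge-disjoint i≢j v = ≟-disjoint (σ-distinct i≢j v)

  adjacent : Fin n → Fin n → Bool
  adjacent v w = edge 0F v w ∨ (edge 1F v w ∨ edge 2F v w)

  graph : Graph n
  graph = record
    { adj    = adjacent
    ; sym    = λ v w →
        cong₂ _∨_ (edge-sym 0F v w) (cong₂ _∨_ (edge-sym 1F v w) (edge-sym 2F v w))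
    ; irrefl = λ v →
        cong₂ _∨_ (edge-irrefl 0F v) (cong₂ _∨_ (edge-irrefl 1F v) (edge-irrefl 2F v))
    }

  cubic : Cubic graph
  cubic v = begin
    count (adjacent v)
      ≡⟨ count-∨ {f = edge 0F v} (λ w e₀ →
           cong₂ _∨_ (edge-disjoint (λ ()) v w e₀) (edge-disjoint (λ ()) v w e₀)) ⟩
    count (edge 0F v) + count (λ w → edge 1F v w ∨ edge 2F v w)
      ≡⟨ cong (count (edge 0F v) +_) (count-∨ {f = edge 1F v} (edge-disjoint (λ ()) v)) ⟩
    count (edge 0F v) + (count (edge 1F v) + count (edge 2F v))
      ≡⟨ cong₂ _+_ (count-≟ (σ 0F v)) (cong₂ _+_ (count-≟ (σ 1F v)) (count-≟ (σ 2F v))) ⟩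
    3 ∎
    where open ≡-Reasoning

  adjacent-σ : ∀ i v → adjacent v (σ i v) ≡ true
  adjacent-σ 0F v rewrite dec-true (σ 0F v ≟ σ 0F v) refl = refl
  adjacent-σ 1F v rewrite dec-true (σ 1F v ≟ σ 1F v) refl = ∨-zeroʳ _
  adjacent-σ 2F v
    rewrite dec-true (σ 2F v ≟ σ 2F v) refl | ∨-zeroʳ (does (σ 2F v ≟ σ 1F v)) = ∨-zeroʳ _

  adjacent⇒σ : ∀ v w → adjacent v w ≡ true → ∃ λ i → w ≡ σ i v
  adjacent⇒σ v w vw with w ≟ σ 0F v | w ≟ σ 1F v | w ≟ σ 2F v
  ... | yes w≡σ₀ | _        | _        = 0F , w≡σ₀
  ... | no _     | yes w≡σ₁ | _        = 1F , w≡σ₁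
  ... | no _     | no _     | yes w≡σ₂ = 2F , w≡σ₂
  adjacent⇒σ v w () | no _ | no _ | no _

  travel : V → List (Fin 3) → V
  travel a []       = a
  travel a (i ∷ is) = travel (τ i a) is

  walk-travel : ∀ a is → Walk graph (from a) (from (travel a is))
  walk-travel a []       = here
  walk-travel a (i ∷ is) = step edge-τ (walk-travel (τ i a) is)
    where
    edge-τ : adjacent (from a) (from (τ i a)) ≡ true
    edge-τ = subst (λ b → adjacent (from a) (from (τ i b)) ≡ true) (strictlyInverseˡ a)
                   (adjacent-σ i (from a))

-- A connected cubic ring of gadgets

prev : ∀ {k} → Fin (suc k) → Fin (suc k)
prev {k} zero = fromℕ k
prev (suc i)  = inject₁ i

next : ∀ {k} → Fin (suc k) → Fin (suc k)
next {zero}  zero    = zero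
next {suc k} zero    = 1F
next {suc k} (suc i) = punchIn 1F (next i)

next-inject₁ : ∀ {k} (i : Fin k) → next (inject₁ i) ≡ suc i
next-inject₁ {suc k} zero    = refl
next-inject₁ {suc k} (suc i) = cong (punchIn 1F) (next-inject₁ i)

next-fromℕ : ∀ k → next (fromℕ k) ≡ zero
next-fromℕ zero    = refl
next-fromℕ (suc k) = cong (punchIn 1F) (next-fromℕ k)

next-prev : ∀ {k} (c : Fin (suc k)) → next (prev c) ≡ c
next-prev {k} zero = next-fromℕ k
next-prev (suc i)  = next-inject₁ i

prev-punchIn : ∀ {k} (c : Fin (suc k)) → prev (punchIn 1F c) ≡ suc (prev c)
prev-punchIn zero    = refl
prev-punchIn (suc _) = refl

prev-next : ∀ {k} (c : Fin (suc k)) → prev (next c) ≡ c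
prev-next {zero}  zero    = refl
prev-next {suc k} zero    = refl
prev-next {suc k} (suc i) = trans (prev-punchIn (next i)) (cong suc (prev-next i))

-- Three perfect matchings of a cubic graph on Fin 10. In the ring the colour-2 edge {0, 1} of
-- each copy is replaced by edges from vertex 0 to vertex 1 of the previous copy.
gadget : Fin 3 → Fin 10 → Fin 10
gadget 0F = lookup (2F ∷ 4F ∷ 0F ∷ 5F ∷ 1F ∷ 3F ∷ 9F ∷ 8F ∷ 7F ∷ 6F ∷ [])
gadget 1F = lookup (3F ∷ 2F ∷ 1F ∷ 0F ∷ 6F ∷ 7F ∷ 4F ∷ 5F ∷ 9F ∷ 8F ∷ [])
gadget 2F = lookup (1F ∷ 0F ∷ 7F ∷ 6F ∷ 8F ∷ 9F ∷ 3F ∷ 2F ∷ 4F ∷ 5F ∷ [])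

gadget-involutive : ∀ i j → gadget i (gadget i j) ≡ j
gadget-involutive = toWitness {a? = all? λ i → all? λ j → gadget i (gadget i j) ≟ j} tt

gadget-fixpointFree : ∀ i j → gadget i j ≢ j
gadget-fixpointFree = toWitness {a? = all? λ i → all? λ j → ¬? (gadget i j ≟ j)} tt

gadget-distinct : ∀ {i i′} → i ≢ i′ → ∀ j → gadget i j ≢ gadget i′ j
gadget-distinct {i} {i′} = toWitness {a? = all? λ i → all? λ i′ → distinct? i i′} tt i i′
  where
  distinct? : ∀ i i′ → Dec (i ≢ i′ → ∀ j → gadget i j ≢ gadget i′ j)
  distinct? i i′ = ¬? (i ≟ i′) →-dec all? λ j → ¬? (gadget i j ≟ gadget i′ j)

module Ring (k : ℕ) where

  Vertex : Set
  Vertex = Fin (suc k) × Fin 10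

  τ : Fin 3 → Vertex → Vertex
  τ 2F (c , 0F) = prev c , 1F
  τ 2F (c , 1F) = next c , 0F
  τ i  (c , j)  = c , gadget i j

  τ-second : ∀ i c j → proj₂ (τ i (c , j)) ≡ gadget i j
  τ-second 0F c j              = refl
  τ-second 1F c j              = refl
  τ-second 2F c 0F             = refl
  τ-second 2F c 1F             = refl
  τ-second 2F c (suc (suc j))  = refl

  τ-inner : ∀ i c j → τ i (c , suc (suc j)) ≡ (c , gadget i (suc (suc j)))
  τ-inner 0F c j = refl
  τ-inner 1F c j = refl
  τ-inner 2F c j = refl

  τ-involutive : ∀ i a → τ i (τ i a) ≡ a
  τ-involutive 0F (c , j)  = cong (c ,_) (gadget-involutive 0F j)
  τ-involutive 1F (c , j)  = cong (c ,_) (gadget-involutive 1F j)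
  τ-involutive 2F (c , 0F) = cong (_, 0F) (next-prev c)
  τ-involutive 2F (c , 1F) = cong (_, 1F) (prev-next c)
  τ-involutive 2F (c , 2F) = refl
  τ-involutive 2F (c , 3F) = refl
  τ-involutive 2F (c , 4F) = refl
  τ-involutive 2F (c , 5F) = refl
  τ-involutive 2F (c , 6F) = refl
  τ-involutive 2F (c , 7F) = refl
  τ-involutive 2F (c , 8F) = refl
  τ-involutive 2F (c , 9F) = refl

  τ-fixpointFree : ∀ i a → τ i a ≢ a
  τ-fixpointFree i (c , j) τa≡a =
    gadget-fixpointFree i j (trans (sym (τ-second i c j)) (cong proj₂ τa≡a))

  τ-distinct : ∀ {i i′} → i ≢ i′ → ∀ a → τ i a ≢ τ i′ a
  τ-distinct {i} {i′} i≢i′ (c , j) τa≡τ′a =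
    gadget-distinct i≢i′ j (trans (sym (τ-second i c j)) (trans (cong proj₂ τa≡τ′a) (τ-second i′ c j)))

  open ThreeMatchings (*↔× {suc k} {10}) τ τ-involutive τ-fixpointFree τ-distinct public
  open Inverse (*↔× {suc k} {10}) using (to; from; strictlyInverseˡ; strictlyInverseʳ)

  copy₀ : Fin 10 → Fin (suc k * 10)
  copy₀ j = from (zero , j)

  copy₀-injective : Injective _≡_ _≡_ copy₀
  copy₀-injective {i} {j} e =
    cong proj₂ (trans (sym (strictlyInverseˡ (zero , i)))
                      (trans (cong to e) (strictlyInverseˡ (zero , j))))

  nbhd : Fin 8 → Fin 3 → Fin 10
  nbhd i l = gadget l (suc (suc i))

  centre : Fin 8 → Fin (suc k * 10)
  centre i = copy₀ (suc (suc i))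

  nbhd-local : ∀ i w → adjacent (centre i) w ≡ true → ∃ λ l → w ≡ copy₀ (nbhd i l)
  nbhd-local i w h with adjacent⇒σ (centre i) w h
  ... | l , w≡σ =
    l , trans w≡σ (trans (cong (from ∘ τ l) (strictlyInverseˡ (zero , suc (suc i))))
                         (cong from (τ-inner l zero i)))

  open LocalGame nbhd using (Strategy; finish; play; wins?)

  strategy : Strategy
  strategy = play 6F λ where
    nothing   → play 5F λ _ → finish
    (just 0F) → play 8F λ _ → finish
    (just 5F) → play 1F λ where
      (just 8F) → play 7F λ where
        (just 0F) → play 9F λ _ → finish
        _         → finish
      _         → finish
    (just 8F) → play 0F λ where
      (just 5F) → play 7F λ where
        (just 1F) → play 9F λ _ → finish
        _         → finish
      _         → finish
    (just 6F) → finish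
    _         → play 5F λ _ → finish

  stallerWins : StallerWinsSGame graph
  stallerWins =
    LocalStrategy.stallerWins graph copy₀ copy₀-injective nbhd centre nbhd-local strategy
      (toWitness {a? = wins? strategy λ _ → free} tt)

  base : Fin (suc k) → Fin (suc k * 10)
  base c = from (c , 0F)

  route : Fin 10 → List (Fin 3)
  route 0F = []
  route 1F = 0F ∷ 1F ∷ []
  route 2F = 0F ∷ []
  route 3F = 1F ∷ []
  route 4F = 0F ∷ 1F ∷ 0F ∷ []
  route 5F = 1F ∷ 0F ∷ []
  route 6F = 1F ∷ 2F ∷ []
  route 7F = 0F ∷ 2F ∷ []
  route 8F = 0F ∷ 2F ∷ 0F ∷ []
  route 9F = 1F ∷ 0F ∷ 2F ∷ []

  route-travel : ∀ c j → travel (c , 0F) (route j) ≡ (c , j)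
  route-travel c 0F = refl
  route-travel c 1F = refl
  route-travel c 2F = refl
  route-travel c 3F = refl
  route-travel c 4F = refl
  route-travel c 5F = refl
  route-travel c 6F = refl
  route-travel c 7F = refl
  route-travel c 8F = refl
  route-travel c 9F = refl

  in-copy : ∀ c j → Walk graph (base c) (from (c , j))
  in-copy c j = subst (Walk graph (base c) ∘ from) (route-travel c j) (walk-travel (c , 0F) (route j))

  to-next-copy : ∀ c → Walk graph (base c) (base (next c))
  to-next-copy c = walk-++ (in-copy c 1F) (walk-travel (c , 1F) (2F ∷ []))

  from-base₀ : ∀ c → Walk graph (base zero) (base c)
  from-base₀ = <-weakInduction (Walk graph (base zero) ∘ base) here λ i w →
    subst (Walk graph (base zero) ∘ base) (next-inject₁ i) (walk-++ w (to-next-copy (inject₁ i)))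

  connected : Connected graph
  connected = connected-from (base zero) λ v → subst (Walk graph (base zero)) (strictlyInverseʳ v)
    (walk-++ (from-base₀ (proj₁ (to v))) (in-copy (proj₁ (to v)) (proj₂ (to v))))

-- Graphs of large minimum degree

join-splitAt-≡ : ∀ {m n} {v : Fin (m + n)} {r} → splitAt m v ≡ r → join m n r ≡ v
join-splitAt-≡ {m} {n} {v} refl = join-splitAt m n v

module PairedGraph (d : ℕ) where

  data Node : Set where
    x y : Fin d → Node
    t   : Fin (2 ^ d) → Node

  member : Fin (2 ^ d) → Fin d → Bool
  member s i = Inverse.to 2↔Bool (finToFun s i)

  code : (Fin d → Bool) → Fin (2 ^ d)
  code f = funToFin (Inverse.from 2↔Bool ∘ f)

  member-code : ∀ f i → member (code f) i ≡ f i
  member-code f i rewrite finToFun-funToFin (Inverse.from 2↔Bool ∘ f) i =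
    Inverse.strictlyInverseˡ 2↔Bool (f i)

  adjacent : Node → Node → Bool
  adjacent (x _) (y _) = true
  adjacent (y _) (x _) = true
  adjacent (x i) (t s) = member s i
  adjacent (t s) (x i) = member s i
  adjacent (y i) (t s) = not (member s i)
  adjacent (t s) (y i) = not (member s i)
  adjacent _     _     = false

  adjacent-sym : ∀ k k′ → adjacent k k′ ≡ adjacent k′ k
  adjacent-sym (x _) (x _) = refl
  adjacent-sym (x _) (y _) = refl
  adjacent-sym (x _) (t _) = refl
  adjacent-sym (y _) (x _) = refl
  adjacent-sym (y _) (y _) = refl
  adjacent-sym (y _) (t _) = refl
  adjacent-sym (t _) (x _) = refl
  adjacent-sym (t _) (y _) = refl
  adjacent-sym (t _) (t _) = refl

  adjacent-irrefl : ∀ k → adjacent k k ≡ false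
  adjacent-irrefl (x _) = refl
  adjacent-irrefl (y _) = refl
  adjacent-irrefl (t _) = refl

  N : ℕ
  N = (d + d) + 2 ^ d

  emb : Node → Fin N
  emb (x j) = (j ↑ˡ d) ↑ˡ 2 ^ d
  emb (y j) = (d ↑ʳ j) ↑ˡ 2 ^ d
  emb (t s) = (d + d) ↑ʳ s

  cls : Fin N → Node
  cls v with splitAt (d + d) v
  ... | inj₂ s = t s
  ... | inj₁ u with splitAt d u
  ...   | inj₁ j = x j
  ...   | inj₂ j = y j

  cls-emb : ∀ k → cls (emb k) ≡ k
  cls-emb (x j) rewrite splitAt-↑ˡ (d + d) (j ↑ˡ d) (2 ^ d) | splitAt-↑ˡ d j d = refl
  cls-emb (y j) rewrite splitAt-↑ˡ (d + d) (d ↑ʳ j) (2 ^ d) | splitAt-↑ʳ d d j = refl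
  cls-emb (t s) rewrite splitAt-↑ʳ (d + d) (2 ^ d) s = refl

  emb-cls : ∀ v → emb (cls v) ≡ v
  emb-cls v with splitAt (d + d) v in split₁
  ... | inj₂ s = join-splitAt-≡ split₁
  ... | inj₁ u with splitAt d u in split₂
  ...   | inj₁ j = trans (cong (_↑ˡ 2 ^ d) (join-splitAt-≡ split₂)) (join-splitAt-≡ split₁)
  ...   | inj₂ j = trans (cong (_↑ˡ 2 ^ d) (join-splitAt-≡ split₂)) (join-splitAt-≡ split₁)

  graph : Graph N
  graph = record
    { adj    = λ u w → adjacent (cls u) (cls w)
    ; sym    = λ u w → adjacent-sym (cls u) (cls w)
    ; irrefl = λ v → adjacent-irrefl (cls v)
    }

  degree-split : ∀ k → count (adjacent k ∘ cls) ≡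
                 (count (adjacent k ∘ x) + count (adjacent k ∘ y)) + count (adjacent k ∘ t)
  degree-split k =
    trans (count-+ (d + d) _)
          (cong₂ _+_ (trans (count-+ d _) (cong₂ _+_ (count-cong (via x)) (count-cong (via y))))
                     (count-cong (via t)))
    where
    via : ∀ {A : Set} (f : A → Node) a → adjacent k (cls (emb (f a))) ≡ adjacent k (f a)
    via f a = cong (adjacent k) (cls-emb (f a))

  minDegree : MinDegreeAtLeast graph d
  minDegree v rewrite degree-split (cls v) = ≤-trans (xy-part (cls v)) (m≤m+n _ _)
    where
    xy-part : ∀ k → d ≤ count (adjacent k ∘ x) + count (adjacent k ∘ y)
    xy-part (x _) = ≤-trans (≤-reflexive (sym (count-true d))) (m≤n+m _ _)
    xy-part (y _) = ≤-trans (≤-reflexive (sym (count-true d))) (m≤m+n _ _)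
    xy-part (t s) = ≤-reflexive (sym (count-complement (member s)))

  mate-node : Node → Maybe Node
  mate-node (x j) = just (y j)
  mate-node (y j) = just (x j)
  mate-node (t _) = nothing

  mate : Fin N → Maybe (Fin N)
  mate v = Maybe.map emb (mate-node (cls v))

  mate-emb : ∀ k → mate (emb k) ≡ Maybe.map emb (mate-node k)
  mate-emb k = cong (Maybe.map emb ∘ mate-node) (cls-emb k)

  mate-node-sym : ∀ {k k′} → mate-node k ≡ just k′ → mate-node k′ ≡ just k
  mate-node-sym {x _} refl = refl
  mate-node-sym {y _} refl = refl

  mate-node-irrefl : ∀ k → mate-node k ≢ just k
  mate-node-irrefl (x _) ()
  mate-node-irrefl (y _) ()
  mate-node-irrefl (t _) ()

  mate-sym : ∀ {v w} → mate v ≡ just w → mate w ≡ just v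
  mate-sym {v} m with mate-node (cls v) in mv
  mate-sym {v} refl | just k =
    trans (mate-emb k) (trans (cong (Maybe.map emb) (mate-node-sym mv)) (cong just (emb-cls v)))

  mate-irrefl : ∀ {v w} → mate v ≡ just w → v ≢ w
  mate-irrefl {v} m v≡w with mate-node (cls v) in mv
  mate-irrefl {v} refl v≡w | just k = mate-node-irrefl k (trans (cong mate-node k≡cls-v) mv)
    where
    k≡cls-v : k ≡ cls v
    k≡cls-v = trans (sym (cls-emb k)) (cong cls (sym v≡w))

  undominated : Owner → Bool
  undominated dom  = false
  undominated free = true
  undominated stal = true

  undominated-false : ∀ {o} → undominated o ≡ false → o ≡ dom
  undominated-false {dom} _ = refl

  undominatedSet : Position N → Fin (2 ^ d)
  undominatedSet p = code λ j → undominated (p (emb (x j)))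

  t-undominated : ∀ p → (∀ j → p (emb (x j)) ≡ dom → p (emb (y j)) ≢ dom) → ¬ DomTD graph p
  t-undominated p split td with td (emb (t (undominatedSet p)))
  ... | w , tw , pw = no-dominated-neighbour (cls w)
                        (subst (λ k → adjacent k (cls w) ≡ true) (cls-emb (t (undominatedSet p))) tw)
                        (trans (cong p (emb-cls w)) pw)
    where
    no-dominated-neighbour : ∀ k → adjacent (t (undominatedSet p)) k ≡ true → p (emb k) ≢ dom
    no-dominated-neighbour (x i) member≡true x-dom
      with () ← trans (sym member≡true) (trans (member-code _ i) (cong undominated x-dom))
    no-dominated-neighbour (y i) nonmember≡true =
      split i (undominated-false (trans (sym (member-code _ i)) (not-injective nonmember≡true)))

  stallerWins : StallerWinsSGame graph
  stallerWins = Pairing.stallerWins graph mate mate-sym mate-irrefl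
    λ split → t-undominated _ λ j → split (mate-emb (x j))

  N>0 : 0 < N
  N>0 = ≤-trans (m^n>0 2 d) (m≤n+m _ _)

corollary3p2 :
    ((m : ℕ) → Σ ℕ λ n → m ≤ n × Σ (Graph n) λ G →
        Cubic G × Connected G × StallerWinsSGame G)
    × ((δ₀ : ℕ) → Σ ℕ λ n → 0 < n × Σ (Graph n) λ G →
        MinDegreeAtLeast G δ₀ × StallerWinsSGame G)
corollary3p2 =
    (λ m → let open Ring m in
      suc m * 10 , ≤-trans (n≤1+n m) (m≤m*n (suc m) 10) , graph , cubic , connected , stallerWins)
  , (λ δ₀ → let open PairedGraph δ₀ in
      N , N>0 , graph , minDegree , stallerWins)
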